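{- (a) Let $k\ge 2$ and let $H$ be obtained from a hypergraph $F\in\mathcal{H}_k$ as follows: for each vertex $v$ of $F$, add $k$ new vertices $v_1,\dots,v_k$ and the two new edges $\{v,v_1,\dots,v_{k-1}\}$ and $\{v_1,v_2,\dots,v_k\}$. Then $\gamma_t(H) = \frac{2n_H}{k+1}$. (b) Let $k\ge 3$ and let $H$ be obtained from a hypergraph $F\in\mathcal{H}_k^*$ as follows: for each vertex $v$ of $F$, add $k+1$ new vertices $v_1,\dots,v_{k+1}$ and the two new edges $\{v,v_1,\dots,v_{k-1}\}$ and $\{v_2,v_3,\dots,v_{k+1}\}$. Then $\gamma_t(H) = \frac{2n_H}{k+2}$.
   Context: A hypergraph $H$ consists of a finite vertex set $V(H)$ and a set (no multiple edges) of subsets of $V(H)$ called edges; $n_H=|V(H)|$. An isolated vertex lies in no edge; an isolated edge is an edge intersecting no other edge. Two vertices are adjacent if some edge contains both. For $k\ge 2$, $\mathcal{H}_k$ is the class of all $k$-uniform hypergraphs with no isolated vertices, no isolated edges and no multiple edges; for $k\ge 3$, $\mathcal{H}_k^*$ is the subclass of $\mathcal{H}_k$ in which no two edges intersect in exactly $k-1$ vertices. A total dominating set of $H$ is a set $D\subseteq V(H)$ such that every vertex of $H$ is adjacent to some vertex of $D$; $\gamma_t(H)$ is its minimum size. -}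

module Defs where

open import Data.Nat using (ℕ; suc; _+_; _*_; _∸_; _<ᵇ_; _≤ᵇ_)
open import Data.Bool using (Bool; true; false; _∧_)
open import Data.Fin using (Fin; toℕ; splitAt; remQuot)
open import Data.Fin.Properties using () renaming (_≟_ to _≟ᶠ_)
open import Data.Fin.Subset using (Subset; _∈_; _∩_; ∣_∣; outside)
open import Data.List using (List; _++_; map; concatMap)
open import Data.List.Membership.Propositional using () renaming (_∈_ to _∈ˡ_)
open import Data.List.Relation.Unary.Unique.Propositional using (Unique)
open import Data.Vec using (Vec; tabulate; replicate) renaming (_++_ to _++ᵛ_)
open import Data.Sum using (inj₁; inj₂)
open import Data.Product using (Σ; ∃; _×_; _,_; proj₁; proj₂)
open import Relation.Nullary using (¬_)
open import Relation.Nullary.Decidable using (⌊_⌋)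
open import Relation.Binary.PropositionalEquality using (_≡_; _≢_)

-- A hypergraph on the vertex set Fin n; edges are subsets of Fin n
-- (Data.Fin.Subset), given as a list.  "No multiple edges" is imposed
-- separately (Unique edges) in the classes below.
record Hypergraph : Set where
  constructor hypergraph
  field
    n     : ℕ
    edges : List (Subset n)
open Hypergraph public

module _ (H : Hypergraph) where

  Adjacent : Fin (n H) → Fin (n H) → Set
  Adjacent u w = u ≢ w × Σ (Subset (n H)) λ e → e ∈ˡ edges H × u ∈ e × w ∈ e

  IsolatedVertex : Fin (n H) → Set
  IsolatedVertex v = ¬ (Σ (Subset (n H)) λ e → e ∈ˡ edges H × v ∈ e)

  IsolatedEdge : Subset (n H) → Set
  IsolatedEdge e = ¬ (Σ (Subset (n H)) λ f → f ∈ˡ edges H × f ≢ e × Σ (Fin (n H)) λ x → x ∈ e × x ∈ f)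

  Uniform : ℕ → Set
  Uniform k = ∀ e → e ∈ˡ edges H → ∣ e ∣ ≡ k

  InHk : ℕ → Set
  InHk k = Uniform k
         × (∀ v → ¬ IsolatedVertex v)
         × (∀ e → e ∈ˡ edges H → ¬ IsolatedEdge e)
         × Unique (edges H)

  InHk* : ℕ → Set
  InHk* k = InHk k
          × (∀ e f → e ∈ˡ edges H → f ∈ˡ edges H → e ≢ f → ¬ (∣ e ∩ f ∣ ≡ k ∸ 1))

  IsTotalDominating : Subset (n H) → Set
  IsTotalDominating D = ∀ u → Σ (Fin (n H)) λ w → w ∈ D × Adjacent u w

  IsγT : ℕ → Set
  IsγT g = (Σ (Subset (n H)) λ D → IsTotalDominating D × ∣ D ∣ ≡ g)
         × (∀ D → IsTotalDominating D → g ≤' ∣ D ∣)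
    where
    open import Data.Nat using () renaming (_≤_ to _≤'_)

-- Given F on Fin m, and r new vertices per old
-- vertex, the new hypergraph has vertex set Fin (m + m * r): old vertex v is
-- v ↑ˡ (m * r) (index v), and the i-th new vertex of v (i : Fin r, i.e.
-- v_{i+1} in the paper's 1-based numbering) is m ↑ʳ combine v i.
-- For each v two new edges are added:
--   A_v = {v} ∪ {v_{i+1} : lo₁ ≤ i < hi₁},   B_v = {v_{i+1} : lo₂ ≤ i < hi₂}.
gadgetEdge : (m r : ℕ) → Bool → Fin m → ℕ → ℕ → Subset (m + m * r)
gadgetEdge m r withV v lo hi = tabulate λ x → mem (splitAt m x)
  where
  mem : _ → Bool
  mem (inj₁ u) = withV ∧ ⌊ u ≟ᶠ v ⌋
  mem (inj₂ y) = ⌊ proj₁ (remQuot {m} r y) ≟ᶠ v ⌋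
                 ∧ (lo ≤ᵇ toℕ (proj₂ (remQuot {m} r y)))
                 ∧ (toℕ (proj₂ (remQuot {m} r y)) <ᵇ hi)

liftEdge : (m r : ℕ) → Subset m → Subset (m + m * r)
liftEdge m r e = e ++ᵛ replicate (m * r) outside

allFin : (m : ℕ) → List (Fin m)
allFin m = Data.List.tabulate {n = m} (λ i → i)
  where import Data.List

constructionA : (k : ℕ) → Hypergraph → Hypergraph
constructionA k F = hypergraph (m + m * k)
  (map (liftEdge m k) (edges F)
   ++ concatMap (λ v → gadgetEdge m k true v 0 (k ∸ 1) Data.List.∷ gadgetEdge m k false v 0 k Data.List.∷ Data.List.[]) (allFin m))
  where
  m = n F
  import Data.List

constructionB : (k : ℕ) → Hypergraph → Hypergraph
constructionB k F = hypergraph (m + m * suc k)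
  (map (liftEdge m (suc k)) (edges F)
   ++ concatMap (λ v → gadgetEdge m (suc k) true v 0 (k ∸ 1) Data.List.∷ gadgetEdge m (suc k) false v 1 (suc k) Data.List.∷ Data.List.[]) (allFin m))
  where
  m = n F
  import Data.List

-- Both constructions attach to every vertex v of F a gadget consisting of v and its new
-- vertices, and γ_t(H) = 2 n_F.  One new vertex of the gadget lies only in the second gadget
-- edge, so its dominator is a new vertex of the same gadget, which in turn needs a dominator
-- inside the gadget: every total dominating set meets each gadget in two vertices.
-- Conversely, all old vertices together with one new vertex per gadget lying in both gadget
-- edges dominate H.  Since n_H = (k + 1) n_F in (a) and (k + 2) n_F in (b), this is the claim.
module Submission where

open import Defs
open import Data.Nat using (ℕ; _≤_; _+_; _*_)
open import Data.Product using (Σ; _×_)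
open import Relation.Binary.PropositionalEquality using (_≡_)

open import Data.Nat using (zero; suc; _<_; z≤n; s≤s; _<?_; _≤ᵇ_; _<ᵇ_)
open import Data.Nat.Properties
  using (≤-trans; ≤-reflexive; n≤1+n; ≮⇒≥; <⇒≱; *-identityʳ; +-suc; ≤ᵇ⇒≤; <ᵇ⇒<; ≤⇒≤ᵇ; <⇒<ᵇ)
open import Data.Nat.Solver using (module +-*-Solver)
open import Data.Bool using (true; false; T; _∧_)
open import Data.Bool.Properties using (T-≡; T-∧)
open import Data.Empty using (⊥-elim)
open import Data.Fin using (Fin; zero; suc; toℕ; fromℕ; splitAt; join; combine; quotRem; remQuot; _↑ˡ_; _↑ʳ_)
open import Data.Fin.Properties
  using (_≟_; suc-injective; toℕ-fromℕ; toℕ<n; ↑ʳ-injective; splitAt-↑ˡ; splitAt-↑ʳ; join-splitAt;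
         combine-injective; combine-remQuot; remQuot-combine)
open import Data.Fin.Subset using (Subset; inside; outside; _∈_; _∉_; ∣_∣; ⊤; ⁅_⁆; _-_)
open import Data.Fin.Subset.Properties using (∣⊤∣≡n; x∈⁅x⁆; ∣⁅x⁆∣≡1; x∈p∧x≢y⇒x∈p-y; x∈p⇒∣p-x∣<∣p∣)
open import Data.List using (List; []; _∷_; map; concatMap) renaming (_++_ to _++ˡ_)
open import Data.List.Membership.Propositional using () renaming (_∈_ to _∈ˡ_)
open import Data.List.Membership.Propositional.Properties using (∈-++⁻; ∈-++⁺ʳ; ∈-map⁻; ∈-allFin; ∈-concatMap⁺; ∈-concatMap⁻)
open import Data.List.Relation.Unary.Any as Any using (here; there)
open import Data.Vec using ([]; _∷_; lookup; replicate; concat; _++_)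
open import Data.Vec.Properties using (lookup∘tabulate; lookup-++ˡ; lookup-++ʳ; lookup-replicate; lookup-concat; []=⇒lookup; lookup⇒[]=)
open import Data.Sum using (_⊎_; inj₁; inj₂; [_,_]′; reduce)
open import Data.Product using (_,_; proj₁; proj₂; swap)
open import Function using (_∘_; id)
open import Function.Bundles using (Equivalence)
open import Function.Definitions using (Injective)
open import Relation.Binary.PropositionalEquality using (_≢_; refl; sym; trans; cong; cong₂; subst; module ≡-Reasoning)
open import Relation.Nullary.Decidable using (⌊_⌋; yes; no; toWitness; fromWitness)

private
  variable
    m m′ r : ℕ

injective-into⇒≤∣p∣ : {f : Fin m → Fin m′} (p : Subset m′) →
                      Injective _≡_ _≡_ f → (∀ i → f i ∈ p) → m ≤ ∣ p ∣
injective-into⇒≤∣p∣ {zero} p _ _ = z≤n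
injective-into⇒≤∣p∣ {suc m} {f = f} p f-inj f∈p =
  ≤-trans (s≤s (injective-into⇒≤∣p∣ (p - f zero) (suc-injective ∘ f-inj) f∘suc∈p-f0))
          (x∈p⇒∣p-x∣<∣p∣ (f∈p zero))
  where
  f∘suc∈p-f0 : ∀ i → f (suc i) ∈ p - f zero
  f∘suc∈p-f0 i = x∈p∧x≢y⇒x∈p-y (f∈p (suc i)) (λ eq → 0≢suc (f-inj (sym eq)))
    where
    0≢suc : zero ≢ suc i
    0≢suc ()

∣p++q∣≡∣p∣+∣q∣ : (p : Subset m) (q : Subset m′) → ∣ p ++ q ∣ ≡ ∣ p ∣ + ∣ q ∣
∣p++q∣≡∣p∣+∣q∣ []            q = refl
∣p++q∣≡∣p∣+∣q∣ (inside  ∷ p) q = cong suc (∣p++q∣≡∣p∣+∣q∣ p q)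
∣p++q∣≡∣p∣+∣q∣ (outside ∷ p) q = ∣p++q∣≡∣p∣+∣q∣ p q

∣concat-replicate∣ : ∀ m (p : Subset r) → ∣ concat (replicate m p) ∣ ≡ m * ∣ p ∣
∣concat-replicate∣ zero    p = refl
∣concat-replicate∣ (suc m) p =
  trans (∣p++q∣≡∣p∣+∣q∣ p _) (cong (∣ p ∣ +_) (∣concat-replicate∣ m p))

∈⇒T-lookup : {x : Fin m} {p : Subset m} → x ∈ p → T (lookup p x)
∈⇒T-lookup x∈p = Equivalence.from T-≡ ([]=⇒lookup x∈p)

T-lookup⇒∈ : {x : Fin m} {p : Subset m} → T (lookup p x) → x ∈ p
T-lookup⇒∈ {x = x} {p} t = lookup⇒[]= x p (Equivalence.to T-≡ t)

-- gadgetEdge tabulates a where-bound membership test that cannot be named here; with-abstracting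
-- splitAt (and quotRem) in the type of its unfolding makes that test compute.
lookup-gadgetEdge-old : ∀ b (v : Fin m) lo hi (u : Fin m) →
  lookup (gadgetEdge m r b v lo hi) (u ↑ˡ (m * r)) ≡ b ∧ ⌊ u ≟ v ⌋
lookup-gadgetEdge-old {m} {r} b v lo hi u
  with splitAt m (u ↑ˡ (m * r)) | splitAt-↑ˡ m u (m * r) | unfolded
  where
  unfolded : lookup (gadgetEdge m r b v lo hi) (u ↑ˡ (m * r)) ≡ _
  unfolded = lookup∘tabulate {n = m + m * r} _ (u ↑ˡ (m * r))
... | _ | refl | eq = eq

lookup-gadgetEdge-new : ∀ b (v : Fin m) lo hi (w : Fin m) (i : Fin r) →
  lookup (gadgetEdge m r b v lo hi) (m ↑ʳ combine w i) ≡ ⌊ w ≟ v ⌋ ∧ (lo ≤ᵇ toℕ i) ∧ (toℕ i <ᵇ hi)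
lookup-gadgetEdge-new {m} {r} b v lo hi w i
  with splitAt m (m ↑ʳ combine w i) | splitAt-↑ʳ m (m * r) (combine w i) | unfolded
  where
  unfolded : lookup (gadgetEdge m r b v lo hi) (m ↑ʳ combine w i) ≡ _
  unfolded = lookup∘tabulate {n = m + m * r} _ (m ↑ʳ combine w i)
... | _ | refl | eq with quotRem {m} r (combine w i) | cong swap (remQuot-combine w i) | eq
...   | _ | refl | eq′ = eq′

old∈gadgetEdge⇒ : ∀ {b} {v : Fin m} {lo hi} {u : Fin m} →
  u ↑ˡ (m * r) ∈ gadgetEdge m r b v lo hi → T b × u ≡ v
old∈gadgetEdge⇒ {b = b} {v} {lo} {hi} {u} u∈e
  with Equivalence.to T-∧ (subst T (lookup-gadgetEdge-old b v lo hi u) (∈⇒T-lookup u∈e))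
... | tb , u≡v = tb , toWitness u≡v

new∈gadgetEdge⇒ : ∀ {b} {v : Fin m} {lo hi} {w : Fin m} {i : Fin r} →
  m ↑ʳ combine w i ∈ gadgetEdge m r b v lo hi → w ≡ v × lo ≤ toℕ i × toℕ i < hi
new∈gadgetEdge⇒ {b = b} {v} {lo} {hi} {w} {i} wi∈e
  with Equivalence.to (T-∧ {⌊ w ≟ v ⌋}) (subst T (lookup-gadgetEdge-new b v lo hi w i) (∈⇒T-lookup wi∈e))
... | w≡v , rest with Equivalence.to (T-∧ {lo ≤ᵇ toℕ i}) rest
...   | lo≤i , i<hi = toWitness w≡v , ≤ᵇ⇒≤ lo (toℕ i) lo≤i , <ᵇ⇒< (toℕ i) hi i<hi

old∈gadgetEdge : ∀ {v : Fin m} {lo hi} → v ↑ˡ (m * r) ∈ gadgetEdge m r true v lo hi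
old∈gadgetEdge {v = v} {lo} {hi} =
  T-lookup⇒∈ (subst T (sym (lookup-gadgetEdge-old true v lo hi v)) (fromWitness {a? = v ≟ v} refl))

new∈gadgetEdge : ∀ {b} {v : Fin m} {lo hi} {i : Fin r} → lo ≤ toℕ i → toℕ i < hi →
  m ↑ʳ combine v i ∈ gadgetEdge m r b v lo hi
new∈gadgetEdge {b = b} {v} {lo} {hi} {i} lo≤i i<hi =
  T-lookup⇒∈ (subst T (sym (lookup-gadgetEdge-new b v lo hi v i))
    (Equivalence.from (T-∧ {⌊ v ≟ v ⌋}) (fromWitness {a? = v ≟ v} refl ,
                           Equivalence.from (T-∧ {lo ≤ᵇ toℕ i}) (≤⇒≤ᵇ lo≤i , <⇒<ᵇ i<hi))))

new∉liftEdge : (e : Subset m) (j : Fin (m * r)) → m ↑ʳ j ∉ liftEdge m r e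
new∉liftEdge {m} {r} e j j∈e =
  subst T (trans (lookup-++ʳ e (replicate (m * r) outside) j) (lookup-replicate j outside)) (∈⇒T-lookup j∈e)

module Corona (m r : ℕ) (E : List (Subset m)) (h₁ l₂ h₂ : ℕ) where

  N : ℕ
  N = m + m * r

  A B : Fin m → Subset N
  A v = gadgetEdge m r true v 0 h₁
  B v = gadgetEdge m r false v l₂ h₂

  H : Hypergraph
  H = hypergraph N (map (liftEdge m r) E ++ˡ concatMap (λ v → A v ∷ B v ∷ []) (allFin m))

  old : Fin m → Fin N
  old u = u ↑ˡ (m * r)

  new : Fin m → Fin r → Fin N
  new v i = m ↑ʳ combine v i

  data View : Fin N → Set where
    old-view : ∀ u → View (old u)
    new-view : ∀ v i → View (new v i)

  view : ∀ x → View x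
  view x with splitAt m x | join-splitAt m (m * r) x
  ... | inj₁ u | refl = old-view u
  ... | inj₂ j | refl = subst (View ∘ (m ↑ʳ_)) (combine-remQuot {m} r j)
                           (new-view (proj₁ (remQuot {m} r j)) (proj₂ (remQuot {m} r j)))

  old≢new : ∀ u v i → old u ≢ new v i
  old≢new u v i eq with trans (sym (splitAt-↑ˡ m u (m * r)))
                              (trans (cong (splitAt m) eq) (splitAt-↑ʳ m (m * r) (combine v i)))
  ... | ()

  new-injective : ∀ {v i w j} → new v i ≡ new w j → v ≡ w × i ≡ j
  new-injective {v} {i} {w} {j} eq = combine-injective v i w j (↑ʳ-injective m (combine v i) (combine w j) eq)

  data InGadget (v : Fin m) : Fin N → Set where
    old-in : InGadget v (old v)
    new-in : ∀ i → InGadget v (new v i)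

  owner : Fin N → Fin m
  owner x = [ id , proj₁ ∘ remQuot {m} r ]′ (splitAt m x)

  InGadget⇒owner : ∀ {v x} → InGadget v x → owner x ≡ v
  InGadget⇒owner {v} old-in     = cong [ id , proj₁ ∘ remQuot {m} r ]′ (splitAt-↑ˡ m v (m * r))
  InGadget⇒owner {v} (new-in i) =
    trans (cong [ id , proj₁ ∘ remQuot {m} r ]′ (splitAt-↑ʳ m (m * r) (combine v i)))
          (cong proj₁ (remQuot-combine v i))

  InGadget-unique : ∀ {v w x} → InGadget v x → InGadget w x → v ≡ w
  InGadget-unique v∋x w∋x = trans (sym (InGadget⇒owner v∋x)) (InGadget⇒owner w∋x)

  gadgetEdges : Fin m → List (Subset N)
  gadgetEdges v = A v ∷ B v ∷ []

  A∈edges : ∀ v → A v ∈ˡ edges H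
  A∈edges v = ∈-++⁺ʳ (map (liftEdge m r) E) (∈-concatMap⁺ gadgetEdges (Any.map (λ where refl → here refl) (∈-allFin v)))

  B∈edges : ∀ v → B v ∈ˡ edges H
  B∈edges v = ∈-++⁺ʳ (map (liftEdge m r) E) (∈-concatMap⁺ gadgetEdges (Any.map (λ where refl → there (here refl)) (∈-allFin v)))

  data EdgeKind : Subset N → Set where
    lifted : ∀ e → EdgeKind (liftEdge m r e)
    edge-A : ∀ v → EdgeKind (A v)
    edge-B : ∀ v → EdgeKind (B v)

  edgeKind : ∀ {e} → e ∈ˡ edges H → EdgeKind e
  edgeKind e∈H with ∈-++⁻ (map (liftEdge m r) E) e∈H
  ... | inj₁ e∈lifted with ∈-map⁻ (liftEdge m r) e∈lifted
  ...   | e′ , _ , refl = lifted e′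
  edgeKind e∈H | inj₂ e∈gadgets with Any.satisfied (∈-concatMap⁻ gadgetEdges {xs = allFin m} e∈gadgets)
  ...   | v , here refl = edge-A v
  ...   | v , there (here refl) = edge-B v

  old∈A⇒ : ∀ {u w} → old u ∈ A w → u ≡ w
  old∈A⇒ {u} {w} u∈A = proj₂ (old∈gadgetEdge⇒ {b = true} {w} {0} {h₁} {u} u∈A)

  old∉B : ∀ {u w} → old u ∉ B w
  old∉B {u} {w} u∈B = proj₁ (old∈gadgetEdge⇒ {b = false} {w} {l₂} {h₂} {u} u∈B)

  new∈A⇒ : ∀ {v i w} → new v i ∈ A w → v ≡ w × toℕ i < h₁
  new∈A⇒ {v} {i} {w} vi∈A with new∈gadgetEdge⇒ {b = true} {w} {0} {h₁} {v} {i} vi∈A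
  ... | v≡w , _ , i<h₁ = v≡w , i<h₁

  new∈B⇒ : ∀ {v i w} → new v i ∈ B w → v ≡ w
  new∈B⇒ {v} {i} {w} vi∈B = proj₁ (new∈gadgetEdge⇒ {b = false} {w} {l₂} {h₂} {v} {i} vi∈B)

  old∈A : ∀ v → old v ∈ A v
  old∈A v = old∈gadgetEdge {v = v} {0} {h₁}

  new∈A : ∀ {v i} → toℕ i < h₁ → new v i ∈ A v
  new∈A {v} {i} = new∈gadgetEdge {b = true} {v} {0} {h₁} {i} z≤n

  new∈B : ∀ {v i} → l₂ ≤ toℕ i → toℕ i < h₂ → new v i ∈ B v
  new∈B {v} {i} = new∈gadgetEdge {b = false} {v} {l₂} {h₂} {i}

  data NewNeighbour (v : Fin m) (i : Fin r) : Fin N → Set where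
    via-A   : toℕ i < h₁ → NewNeighbour v i (old v)
    via-new : ∀ j → NewNeighbour v i (new v j)

  NewNeighbour⇒InGadget : ∀ {v i x} → NewNeighbour v i x → InGadget v x
  NewNeighbour⇒InGadget (via-A _)   = old-in
  NewNeighbour⇒InGadget (via-new j) = new-in j

  edge∋new⇒NewNeighbour : ∀ {e v i x} → e ∈ˡ edges H → new v i ∈ e → x ∈ e → NewNeighbour v i x
  edge∋new⇒NewNeighbour e∈H vi∈e x∈e = go (edgeKind e∈H) vi∈e x∈e (view _)
    where
    go : ∀ {e v i x} → EdgeKind e → new v i ∈ e → x ∈ e → View x → NewNeighbour v i x
    go (lifted e) vi∈e _ _ = ⊥-elim (new∉liftEdge e _ vi∈e)
    go (edge-A w) vi∈A u∈A (old-view u) with new∈A⇒ vi∈A | old∈A⇒ u∈A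
    ... | refl , i<h₁ | refl = via-A i<h₁
    go (edge-A w) vi∈A uj∈A (new-view u j) with new∈A⇒ vi∈A | new∈A⇒ uj∈A
    ... | refl , _ | refl , _ = via-new j
    go (edge-B w) _ u∈B (old-view u) = ⊥-elim (old∉B u∈B)
    go (edge-B w) vi∈B uj∈B (new-view u j) with new∈B⇒ vi∈B | new∈B⇒ uj∈B
    ... | refl | refl = via-new j

  record TwoInGadget (D : Subset N) (v : Fin m) : Set where
    field
      first second  : Fin N
      first∈D       : first ∈ D
      second∈D      : second ∈ D
      first≢second  : first ≢ second
      first-in      : InGadget v first
      second-in     : InGadget v second

  module LowerBound (t : Fin r) (h₁≤t : h₁ ≤ toℕ t) {D : Subset N} (D-dom : IsTotalDominating H D) where

    twoInGadget : ∀ v → TwoInGadget D v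
    twoInGadget v with D-dom (new v t)
    ... | w , w∈D , _ , e , e∈H , vt∈e , w∈e with edge∋new⇒NewNeighbour e∈H vt∈e w∈e
    ...   | via-A t<h₁ = ⊥-elim (<⇒≱ t<h₁ h₁≤t)
    ...   | via-new j with D-dom (new v j)
    ...     | w′ , w′∈D , vj≢w′ , e′ , e′∈H , vj∈e′ , w′∈e′ = record
      { first        = new v j
      ; second       = w′
      ; first∈D      = w∈D
      ; second∈D     = w′∈D
      ; first≢second = vj≢w′
      ; first-in     = new-in j
      ; second-in    = NewNeighbour⇒InGadget (edge∋new⇒NewNeighbour e′∈H vj∈e′ w′∈e′)
      }
    open TwoInGadget

    pick : Fin m ⊎ Fin m → Fin N
    pick (inj₁ v) = first (twoInGadget v)
    pick (inj₂ v) = second (twoInGadget v)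

    pick-in : ∀ s → InGadget (reduce s) (pick s)
    pick-in (inj₁ v) = first-in (twoInGadget v)
    pick-in (inj₂ v) = second-in (twoInGadget v)

    pick∈D : ∀ s → pick s ∈ D
    pick∈D (inj₁ v) = first∈D (twoInGadget v)
    pick∈D (inj₂ v) = second∈D (twoInGadget v)

    pick-injective : Injective _≡_ _≡_ pick
    pick-injective {s} {s′} eq with InGadget-unique (pick-in s) (subst (InGadget (reduce s′)) (sym eq) (pick-in s′))
    pick-injective {inj₁ v} {inj₁ _} eq | refl = refl
    pick-injective {inj₁ v} {inj₂ _} eq | refl = ⊥-elim (first≢second (twoInGadget v) eq)
    pick-injective {inj₂ v} {inj₁ _} eq | refl = ⊥-elim (first≢second (twoInGadget v) (sym eq))
    pick-injective {inj₂ v} {inj₂ _} eq | refl = refl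

    lower-bound : m + m ≤ ∣ D ∣
    lower-bound = injective-into⇒≤∣p∣ D (splitAt-injective ∘ pick-injective) (pick∈D ∘ splitAt m)
      where
      splitAt-injective : Injective _≡_ _≡_ (splitAt m {m})
      splitAt-injective {i} {j} eq =
        trans (sym (join-splitAt m m i)) (trans (cong (join m m) eq) (join-splitAt m m j))

  module UpperBound (c : Fin r) (c<h₁ : toℕ c < h₁) (l₂≤c : l₂ ≤ toℕ c) (c<h₂ : toℕ c < h₂)
                    (outside-A⇒in-B : ∀ (i : Fin r) → h₁ ≤ toℕ i → l₂ ≤ toℕ i × toℕ i < h₂) where

    core : Subset N
    core = ⊤ {m} ++ concat (replicate m ⁅ c ⁆)

    ∣core∣ : ∣ core ∣ ≡ m + m
    ∣core∣ = begin
      ∣ core ∣                                  ≡⟨ ∣p++q∣≡∣p∣+∣q∣ (⊤ {m}) _ ⟩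
      ∣ ⊤ {m} ∣ + ∣ concat (replicate m ⁅ c ⁆) ∣ ≡⟨ cong₂ _+_ (∣⊤∣≡n m) (∣concat-replicate∣ m ⁅ c ⁆) ⟩
      m + m * ∣ ⁅ c ⁆ ∣                         ≡⟨ cong (λ k → m + m * k) (∣⁅x⁆∣≡1 c) ⟩
      m + m * 1                                 ≡⟨ cong (m +_) (*-identityʳ m) ⟩
      m + m                                     ∎
      where open ≡-Reasoning

    old∈core : ∀ v → old v ∈ core
    old∈core v = lookup⇒[]= (old v) core (trans (lookup-++ˡ (⊤ {m}) _ v) (lookup-replicate v inside))

    new∈core : ∀ v → new v c ∈ core
    new∈core v = lookup⇒[]= (new v c) core (begin
      lookup core (m ↑ʳ combine v c)                    ≡⟨ lookup-++ʳ (⊤ {m}) _ (combine v c) ⟩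
      lookup (concat (replicate m ⁅ c ⁆)) (combine v c) ≡⟨ lookup-concat (replicate m ⁅ c ⁆) v c ⟩
      lookup (lookup (replicate m ⁅ c ⁆) v) c           ≡⟨ cong (λ p → lookup p c) (lookup-replicate v ⁅ c ⁆) ⟩
      lookup ⁅ c ⁆ c                                    ≡⟨ []=⇒lookup (x∈⁅x⁆ c) ⟩
      inside                                            ∎)
      where open ≡-Reasoning

    core-dominating : IsTotalDominating H core
    core-dominating x with view x
    ... | old-view v = new v c , new∈core v , old≢new v v c , A v , A∈edges v , old∈A v , new∈A c<h₁
    ... | new-view v i with toℕ i <? h₁
    ...   | yes i<h₁ = old v , old∈core v , old≢new v v i ∘ sym , A v , A∈edges v , new∈A i<h₁ , old∈A v
    ...   | no i≮h₁  = new v c , new∈core v , i≢c , B v , B∈edges v , new∈B l₂≤i i<h₂ , new∈B l₂≤c c<h₂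
      where
      l₂≤i = proj₁ (outside-A⇒in-B i (≮⇒≥ i≮h₁))
      i<h₂ = proj₂ (outside-A⇒in-B i (≮⇒≥ i≮h₁))
      i≢c : new v i ≢ new v c
      i≢c eq = i≮h₁ (subst (λ j → toℕ j < h₁) (sym (proj₂ (new-injective eq))) c<h₁)

  IsγT-m+m : (t : Fin r) → h₁ ≤ toℕ t →
             (c : Fin r) → toℕ c < h₁ → l₂ ≤ toℕ c → toℕ c < h₂ →
             (∀ (i : Fin r) → h₁ ≤ toℕ i → l₂ ≤ toℕ i × toℕ i < h₂) →
             IsγT H (m + m)
  IsγT-m+m t h₁≤t c c<h₁ l₂≤c c<h₂ outside-A⇒in-B =
    (core , core-dominating , ∣core∣) , λ D D-dom → LowerBound.lower-bound t h₁≤t D-dom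
    where open UpperBound c c<h₁ l₂≤c c<h₂ outside-A⇒in-B

-- Witnesses: t is v_k, outside A v; c is v_1, in both gadget edges.
γT-constructionA : ∀ k → 2 ≤ k → (F : Hypergraph) → IsγT (constructionA k F) (n F + n F)
γT-constructionA (suc (suc k)) (s≤s (s≤s z≤n)) F =
  Corona.IsγT-m+m (n F) (2 + k) (edges F) (suc k) 0 (2 + k)
    (fromℕ (suc k)) (≤-reflexive (sym (toℕ-fromℕ (suc k))))
    zero (s≤s z≤n) z≤n (s≤s z≤n)
    (λ i _ → z≤n , toℕ<n i)

-- Witnesses: t is v_{k+1}, outside A v; c is v_2, in both gadget edges (here k ≥ 3 is used).
γT-constructionB : ∀ k → 3 ≤ k → (F : Hypergraph) → IsγT (constructionB k F) (n F + n F)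
γT-constructionB (suc (suc (suc k))) (s≤s (s≤s (s≤s z≤n))) F =
  Corona.IsγT-m+m (n F) (4 + k) (edges F) (2 + k) 1 (4 + k)
    (fromℕ (3 + k)) (≤-trans (n≤1+n (2 + k)) (≤-reflexive (sym (toℕ-fromℕ (3 + k)))))
    (suc zero) (s≤s (s≤s z≤n)) (s≤s z≤n) (s≤s (s≤s z≤n))
    (λ i 2+k≤i → ≤-trans (s≤s z≤n) 2+k≤i , toℕ<n i)

[r+1]*[m+m]≡2*[m+m*r] : ∀ m r → (r + 1) * (m + m) ≡ 2 * (m + m * r)
[r+1]*[m+m]≡2*[m+m*r] = solve 2 (λ m r → (r :+ con 1) :* (m :+ m) := con 2 :* (m :+ m :* r)) refl
  where open +-*-Solver

mainTheorem7 : ((k : ℕ) → 2 ≤ k → (F : Hypergraph) → InHk F k → Σ ℕ λ g → IsγT (constructionA k F) g × (k + 1) * g ≡ 2 * n (constructionA k F))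
    × ((k : ℕ) → 3 ≤ k → (F : Hypergraph) → InHk* F k → Σ ℕ λ g → IsγT (constructionB k F) g × (k + 2) * g ≡ 2 * n (constructionB k F))
mainTheorem7 =
  (λ k 2≤k F _ → n F + n F , γT-constructionA k 2≤k F , [r+1]*[m+m]≡2*[m+m*r] (n F) k) ,
  (λ k 3≤k F _ → n F + n F , γT-constructionB k 3≤k F ,
     trans (cong (_* (n F + n F)) (+-suc k 1)) ([r+1]*[m+m]≡2*[m+m*r] (n F) (suc k)))
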